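{- Let $G$ be a graph, $k$ a positive integer, and $A,B,C\subseteq V(G)$ with $|B|=2k-1$. If there is a set of $2k-1$ disjoint paths linking $A$ and $B$ and a set of $2k-1$ disjoint paths linking $B$ and $C$, then there are $k$ disjoint paths in $G$ linking $A$ and $C$. -}

module Defs where

open import Data.Nat using (ℕ)
open import Data.Fin using (Fin)
open import Data.Fin.Subset using (Subset; _∈_; _∉_)
open import Data.List using (List; []; _∷_; _∷ʳ_)
open import Data.List.Relation.Unary.All using (All)
open import Data.List.Relation.Unary.Unique.Propositional using (Unique)
open import Data.List.Relation.Unary.Linked using (Linked)
import Data.List.Membership.Propositional as L
open import Data.Product using (Σ; ∃; ∃₂; _×_)
open import Relation.Binary.PropositionalEquality using (_≡_)
open import Relation.Nullary using (¬_)

record Graph : Set₁ where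
  field
    n      : ℕ
    _~_    : Fin n → Fin n → Set
    ~-sym  : ∀ {x y} → x ~ y → y ~ x
    ~-irr  : ∀ {x} → ¬ (x ~ x)

module _ (G : Graph) where
  open Graph G

  V : Set
  V = Fin n

  IsPath : List V → Set
  IsPath vs = (∃ λ x → ∃ λ xs → vs ≡ x ∷ xs) × Linked _~_ vs × Unique vs

  -- An A–B path (Diestel): P = x₀ … x_l with V(P) ∩ A = {x₀} and V(P) ∩ B = {x_l}.
  IsABPath : Subset n → Subset n → List V → Set
  IsABPath A B vs =
    IsPath vs
    × (∃₂ λ a rest → vs ≡ a ∷ rest × a ∈ A × All (λ v → v ∉ A) rest)
    × (∃₂ λ ini b → vs ≡ ini ∷ʳ b × b ∈ B × All (λ v → v ∉ B) ini)

  Linkage : ℕ → Subset n → Subset n → Set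
  Linkage m A B =
    Σ (Fin m → List V) λ P →
      (∀ i → IsABPath A B (P i))
      × (∀ i j v → v L.∈ P i → v L.∈ P j → i ≡ j)

module Submission where

-- Let H be the subgraph formed by the edges of all Pᵢ and Qⱼ.  By Menger's
-- theorem, H contains k disjoint A–C paths unless a set S of fewer than k vertices
-- separates A from C in H.  The Qⱼ start at 2k-1 distinct vertices of B, i.e. at all of
-- them, so every Pᵢ ends where some Qⱼ starts; the walk PᵢQⱼ joins A to C in H, so S
-- meets Pᵢ or this Qⱼ.  Such a vertex, tagged with the side (P or Q) it lies on, defines
-- an injection from the 2k-1 paths Pᵢ into two copies of S: 2k-1 ≤ 2|S| ≤ 2k-2, absurd.

open import Defs
open import Data.Empty using (⊥; ⊥-elim)
open import Data.Fin.Subset using (Subset; ∣_∣; _∈_; _∉_; inside; outside)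
open import Data.Fin.Subset.Properties using (_∈?_)
open import Data.Fin as Fin using (Fin; zero; suc)
import Data.Fin.Properties as Finₚ
open import Data.List as List using (List; []; _∷_; _++_; _∷ʳ_; length; filter; allFin; map)
import Data.List.Properties as Listₚ
open import Data.List.Membership.Propositional using (find) renaming (_∈_ to _∈ₗ_; _∉_ to _∉ₗ_)
open import Data.List.Membership.Propositional.Properties
  using (∈-filter⁺; ∈-filter⁻; ∈-map⁺; ∈-map⁻; ∈-lookup; ∈-allFin; ∈-++⁺ˡ; ∈-++⁺ʳ; ∈-++⁻; ∈-concatMap⁺; ∈-concatMap⁻)
open import Data.List.Relation.Unary.All as All using (All; []; _∷_)
open import Data.List.Relation.Unary.Any as Any using (Any; here; there)
open import Data.List.Relation.Unary.Linked as Linked using (Linked; []; [-]; _∷_)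
import Data.List.Relation.Unary.AllPairs as AllPairs
open AllPairs using ([]; _∷_)
open import Data.List.Relation.Unary.Unique.Propositional using (Unique)
import Data.List.Relation.Unary.Unique.Propositional.Properties as Uniqueₚ
import Data.List.Relation.Unary.All.Properties as Allₚ
open import Data.List.Relation.Unary.All.Properties.Core using (¬Any⇒All¬)
open import Data.Nat using (ℕ; zero; suc; _+_; _*_; _∸_; _≤_; _<_; z≤n; s≤s)
import Data.Nat.Properties as ℕₚ
open import Data.Product as Product using (Σ; ∃; _×_; _,_; proj₁; proj₂)
open import Data.Sum as Sum using (_⊎_; inj₁; inj₂)
open import Data.Sum.Properties using (≡-dec)
open import Data.Vec using ([]; _∷_)
open import Data.Unit using (⊤; tt)
open import Function using (_∘_)
open import Function.Definitions using (Injective)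
open import Level using (0ℓ)
open import Relation.Binary using (Rel)
open import Relation.Unary using (Pred; Decidable)
open import Relation.Nullary.Decidable using (_×-dec_; _⊎-dec_)
open import Relation.Binary.Definitions using (DecidableEquality)
open import Relation.Binary.PropositionalEquality using (_≡_; _≢_; refl; sym; trans; cong; cong₂; subst; subst₂)
open import Relation.Nullary using (¬_; yes; no; ¬?)

module Counting {a} {X : Set a} (_≟_ : DecidableEquality X) where

  unique⊆⇒length≤ : ∀ {xs ys : List X} → Unique xs → (∀ {v} → v ∈ₗ xs → v ∈ₗ ys) →
                    length xs ≤ length ys
  unique⊆⇒length≤ {[]} _ _ = z≤n
  unique⊆⇒length≤ {x ∷ xs} {ys} (x∉xs ∷ unique) xs⊆ys =
    ℕₚ.≤-trans (s≤s (unique⊆⇒length≤ unique xs⊆ys-x)) (Listₚ.filter-notAll ≢x? ys x∈ys)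
    where
      ≢x? : Decidable (_≢ x)
      ≢x? z = ¬? (z ≟ x)
      xs⊆ys-x : ∀ {v} → v ∈ₗ xs → v ∈ₗ filter ≢x? ys
      xs⊆ys-x v∈xs = ∈-filter⁺ ≢x? (xs⊆ys (there v∈xs)) (λ v≡x → All.lookup x∉xs v∈xs (sym v≡x))
      x∈ys : Any (λ z → ¬ ¬ (z ≡ x)) ys
      x∈ys = Any.map (λ z≡x z≢x → z≢x (sym z≡x)) (xs⊆ys (here refl))

  injection⇒≤ : ∀ {m} {ys : List X} (f : Fin m → X) → Injective _≡_ _≡_ f →
                (∀ i → f i ∈ₗ ys) → m ≤ length ys
  injection⇒≤ {m} {ys} f f-inj f∈ys =
    subst (_≤ length ys) length-image (unique⊆⇒length≤ (Uniqueₚ.map⁺ f-inj (Uniqueₚ.allFin⁺ m)) image⊆ys)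
    where
      length-image : length (map f (allFin m)) ≡ m
      length-image = trans (Listₚ.length-map f (allFin m)) (Listₚ.length-tabulate (λ i → i))
      image⊆ys : ∀ {v} → v ∈ₗ map f (allFin m) → v ∈ₗ ys
      image⊆ys v∈ with ∈-map⁻ f v∈
      ... | i , _ , refl = f∈ys i

  injection-onto : ∀ {m} {ys : List X} (f : Fin m → X) → Injective _≡_ _≡_ f →
                   (∀ i → f i ∈ₗ ys) → length ys ≤ m → ∀ {t} → t ∈ₗ ys → ∃ λ i → f i ≡ t
  injection-onto {m} {ys} f f-inj f∈ys ys≤m {t} t∈ys with Finₚ.any? (λ i → f i ≟ t)
  ... | yes hit = hit
  ... | no miss = ⊥-elim (ℕₚ.<-irrefl refl (ℕₚ.≤-<-trans m≤ys-t (ℕₚ.<-≤-trans ys-t<ys ys≤m)))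
    where
      ≢t? : Decidable (_≢ t)
      ≢t? z = ¬? (z ≟ t)
      m≤ys-t : m ≤ length (filter ≢t? ys)
      m≤ys-t = injection⇒≤ f f-inj (λ i → ∈-filter⁺ ≢t? (f∈ys i) (λ fi≡t → miss (i , fi≡t)))
      ys-t<ys : length (filter ≢t? ys) < length ys
      ys-t<ys = Listₚ.filter-notAll ≢t? ys (Any.map (λ z≡t z≢t → z≢t (sym z≡t)) t∈ys)

-- Paths are represented as a first vertex x followed by the list xs of the others.
module _ {Node : Set} where

  last : Node → List Node → Node
  last x [] = x
  last x (y ∷ ys) = last y ys

  init : Node → List Node → List Node
  init x [] = []
  init x (y ∷ ys) = x ∷ init y ys

  AllButLast : (Node → Set) → Node → List Node → Set
  AllButLast P x [] = ⊤
  AllButLast P x (y ∷ ys) = P x × AllButLast P y ys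

  last-∈ : ∀ x xs → last x xs ∈ₗ x ∷ xs
  last-∈ x [] = here refl
  last-∈ x (y ∷ ys) = there (last-∈ y ys)

  last-++ : ∀ x xs ys → last x (xs ++ ys) ≡ last (last x xs) ys
  last-++ x [] ys = refl
  last-++ x (y ∷ xs) ys = last-++ y xs ys

  init-∷ʳ-last : ∀ x xs → x ∷ xs ≡ init x xs ∷ʳ last x xs
  init-∷ʳ-last x [] = refl
  init-∷ʳ-last x (y ∷ ys) = cong (x ∷_) (init-∷ʳ-last y ys)

  allButLast⇒All-init : ∀ {P : Node → Set} x xs → AllButLast P x xs → All P (init x xs)
  allButLast⇒All-init x [] _ = []
  allButLast⇒All-init x (y ∷ ys) (px , rest) = px ∷ allButLast⇒All-init y ys rest

  All-init⇒allButLast : ∀ {P : Node → Set} x xs → All P (init x xs) → AllButLast P x xs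
  All-init⇒allButLast x [] _ = tt
  All-init⇒allButLast x (y ∷ ys) (px ∷ rest) = px , All-init⇒allButLast y ys rest

  allButLast-map : ∀ {P Q : Node → Set} → (∀ {v} → P v → Q v) →
                   ∀ {x xs} → AllButLast P x xs → AllButLast Q x xs
  allButLast-map f {xs = []} _ = tt
  allButLast-map f {xs = y ∷ ys} (px , rest) = f px , allButLast-map f rest

  allButLast-∈ : ∀ {P : Node → Set} {x xs v} → AllButLast P x xs → v ∈ₗ x ∷ xs → P v ⊎ v ≡ last x xs
  allButLast-∈ {xs = []} _ (here v≡x) = inj₂ v≡x
  allButLast-∈ {xs = y ∷ ys} (px , _) (here refl) = inj₁ px
  allButLast-∈ {xs = y ∷ ys} (_ , rest) (there v∈) = allButLast-∈ rest v∈

  allButLast-++ : ∀ {P : Node → Set} {x xs ys} → AllButLast P x xs → AllButLast P (last x xs) ys →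
                  AllButLast P x (xs ++ ys)
  allButLast-++ {xs = []} _ rest = rest
  allButLast-++ {xs = y ∷ xs} (px , first) rest = px , allButLast-++ first rest

  lookup-injective : ∀ {xs : List Node} → Unique xs → ∀ i j → List.lookup xs i ≡ List.lookup xs j → i ≡ j
  lookup-injective (_ ∷ _) zero zero _ = refl
  lookup-injective (x∉xs ∷ _) zero (suc j) x≡ = ⊥-elim (All.lookup x∉xs (∈-lookup j) x≡)
  lookup-injective (x∉xs ∷ _) (suc i) zero ≡x = ⊥-elim (All.lookup x∉xs (∈-lookup i) (sym ≡x))
  lookup-injective (_ ∷ unique) (suc i) (suc j) eq = cong suc (lookup-injective unique i j eq)

  linked-++ : ∀ {E : Node → Node → Set} {x xs ys} → Linked E (x ∷ xs) → Linked E (last x xs ∷ ys) →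
              Linked E (x ∷ xs ++ ys)
  linked-++ {xs = []} _ second = second
  linked-++ {xs = y ∷ xs} (e ∷ first) second = e ∷ linked-++ first second

-- Menger's theorem for graphs on Fin n whose edges are given by a finite list, in the
-- constructive form: k disjoint A–B paths, or a certificate that fewer than k vertices
-- separate A from B.  The proof is the induction on the number of edges from Diestel's
-- first proof of Menger's theorem.
module Menger (n : ℕ) where
  open import Data.List.Membership.DecPropositional (Finₚ._≟_ {n}) using () renaming (_∈?_ to _∈ₗ?_)

  Vertex : Set
  Vertex = Fin n

  record IsLinkPath (E : Rel Vertex 0ℓ) (A B : Pred Vertex 0ℓ) (x : Vertex) (xs : List Vertex) : Set where
    field
      first∈A  : A x
      rest∉A   : All (λ v → ¬ A v) xs
      linked   : Linked E (x ∷ xs)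
      distinct : Unique (x ∷ xs)
      inner∉B  : AllButLast (λ v → ¬ B v) x xs
      last∈B   : B (last x xs)

  record Linking (E : Rel Vertex 0ℓ) (k : ℕ) (A B : Pred Vertex 0ℓ) : Set where
    field
      first    : Fin k → Vertex
      rest     : Fin k → List Vertex
      isPath   : ∀ i → IsLinkPath E A B (first i) (rest i)
      disjoint : ∀ i j {v} → v ∈ₗ first i ∷ rest i → v ∈ₗ first j ∷ rest j → i ≡ j

    vertices : Fin k → List Vertex
    vertices i = first i ∷ rest i

    end : Fin k → Vertex
    end i = last (first i) (rest i)

    first-injective : Injective _≡_ _≡_ first
    first-injective {i} {j} fi≡fj = disjoint i j (here refl) (here fi≡fj)

    end-injective : Injective _≡_ _≡_ end
    end-injective {i} {j} ei≡ej =
      disjoint i j (last-∈ (first i) (rest i)) (subst (_∈ₗ first j ∷ rest j) (sym ei≡ej) (last-∈ (first j) (rest j)))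

  -- A certificate that fewer than k vertices separate A from B along E: the vertex set
  -- `reach` (think: reachable from A avoiding sep) covers A outside sep, misses sep and B,
  -- and is closed under E-edges that do not enter sep.
  record Separation (E : Rel Vertex 0ℓ) (A B : Pred Vertex 0ℓ) (k : ℕ) : Set₁ where
    field
      sep         : List Vertex
      sep-small   : length sep < k
      reach       : Pred Vertex 0ℓ
      reach?      : Decidable reach
      reach∉sep   : ∀ {v} → reach v → v ∉ₗ sep
      A⊆reach∪sep : ∀ {v} → A v → reach v ⊎ v ∈ₗ sep
      B-unreached : ∀ {v} → B v → ¬ reach v
      closed      : ∀ {u v} → reach u → E u v → v ∉ₗ sep → reach v

    outside⇒∉A : ∀ {v} → ¬ reach v → v ∉ₗ sep → ¬ A v
    outside⇒∉A v∉reach v∉sep v∈A with A⊆reach∪sep v∈A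
    ... | inj₁ v∈reach = v∉reach v∈reach
    ... | inj₂ v∈sep = v∉sep v∈sep

    reach-along : ∀ {x xs} → reach x → Linked E (x ∷ xs) → All (_∉ₗ sep) xs → reach (last x xs)
    reach-along {xs = []} x∈reach _ _ = x∈reach
    reach-along {xs = y ∷ ys} x∈reach (xy ∷ linked) (y∉sep ∷ ys∉sep) =
      reach-along (closed x∈reach xy y∉sep) linked ys∉sep

    inner-stays : ∀ {x xs} → reach x → Linked E (x ∷ xs) → AllButLast (_∉ₗ sep) x xs → AllButLast reach x xs
    inner-stays {xs = []} _ _ _ = tt
    inner-stays {xs = y ∷ []} x∈reach _ _ = x∈reach , tt
    inner-stays {xs = y ∷ z ∷ zs} x∈reach (xy ∷ linked) (_ , inner∉sep@(y∉sep , _)) =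
      x∈reach , inner-stays (closed x∈reach xy y∉sep) linked inner∉sep

    -- The same for a walk from A: unless it is a single vertex, it starts outside sep, hence in reach.
    inner-reached : ∀ {x xs} → A x → Linked E (x ∷ xs) → AllButLast (_∉ₗ sep) x xs → AllButLast reach x xs
    inner-reached {xs = []} _ _ _ = tt
    inner-reached {xs = y ∷ ys} x∈A linked inner∉sep@(x∉sep , _) with A⊆reach∪sep x∈A
    ... | inj₁ x∈reach = inner-stays x∈reach linked inner∉sep
    ... | inj₂ x∈sep = ⊥-elim (x∉sep x∈sep)

    unreached-after-start : ∀ {x xs} → Linked E (x ∷ xs) → All (_∉ₗ sep) xs → B (last x xs) →
                            All (λ v → ¬ reach v) xs
    unreached-after-start {xs = []} _ _ _ = []
    unreached-after-start {xs = y ∷ ys} (_ ∷ linked) (_ ∷ ys∉sep) end∈B =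
      (λ y∈reach → B-unreached end∈B (reach-along y∈reach linked ys∉sep))
      ∷ unreached-after-start linked ys∉sep end∈B

  LinkingOrSeparation : Rel Vertex 0ℓ → ℕ → Pred Vertex 0ℓ → Pred Vertex 0ℓ → Set₁
  LinkingOrSeparation E k A B = Linking E k A B ⊎ Separation E A B k

  -- Without edges every A–B path is a single vertex of A ∩ B: either A ∩ B has k
  -- vertices, or A ∩ B itself is a small separator.
  module Edgeless {E : Rel Vertex 0ℓ} (no-edge : ∀ {u v} → ¬ E u v)
                  {A B : Pred Vertex 0ℓ} (A? : Decidable A) (B? : Decidable B) where

    A∩B? : Decidable (λ v → A v × B v)
    A∩B? v = A? v ×-dec B? v

    A∩B : List Vertex
    A∩B = filter A∩B? (allFin n)

    trivial-linking : ∀ {k} → k ≤ length A∩B → Linking E k A B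
    trivial-linking {k} k≤ = record
      { first = vertex ; rest = λ _ → [] ; isPath = single ; disjoint = disjoint }
      where
        vertex : Fin k → Vertex
        vertex i = List.lookup A∩B (Fin.inject≤ i k≤)
        vertex∈A∩B : ∀ i → A (vertex i) × B (vertex i)
        vertex∈A∩B i = proj₂ (∈-filter⁻ A∩B? {xs = allFin n} (∈-lookup (Fin.inject≤ i k≤)))
        single : ∀ i → IsLinkPath E A B (vertex i) []
        single i = record
          { first∈A = proj₁ (vertex∈A∩B i) ; rest∉A = [] ; linked = [-] ; distinct = [] ∷ []
          ; inner∉B = tt ; last∈B = proj₂ (vertex∈A∩B i) }
        disjoint : ∀ i j {v} → v ∈ₗ vertex i ∷ [] → v ∈ₗ vertex j ∷ [] → i ≡ j
        disjoint i j (here refl) (here vi≡vj) =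
          Finₚ.inject≤-injective k≤ k≤ i j
            (lookup-injective (Uniqueₚ.filter⁺ A∩B? (Uniqueₚ.allFin⁺ n)) _ _ vi≡vj)

    trivial-separation : ∀ {k} → length A∩B < k → Separation E A B k
    trivial-separation small = record
      { sep = A∩B ; sep-small = small ; reach = λ v → A v × ¬ B v ; reach? = λ v → A? v ×-dec ¬? (B? v)
      ; reach∉sep = λ (_ , v∉B) v∈A∩B → v∉B (proj₂ (proj₂ (∈-filter⁻ A∩B? {xs = allFin n} v∈A∩B)))
      ; A⊆reach∪sep = covered ; B-unreached = λ v∈B (_ , v∉B) → v∉B v∈B
      ; closed = λ _ uv _ → ⊥-elim (no-edge uv) }
      where
        covered : ∀ {v} → A v → (A v × ¬ B v) ⊎ v ∈ₗ A∩B
        covered {v} v∈A with B? v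
        ... | yes v∈B = inj₂ (∈-filter⁺ A∩B? (∈-allFin v) (v∈A , v∈B))
        ... | no v∉B = inj₁ (v∈A , v∉B)

    linkingOrSeparation : ∀ k → LinkingOrSeparation E k A B
    linkingOrSeparation k with k ℕₚ.≤? length A∩B
    ... | yes k≤ = inj₁ (trivial-linking k≤)
    ... | no k≰ = inj₂ (trivial-separation (ℕₚ.≰⇒> k≰))

  ++-isLinkPath : ∀ {E : Rel Vertex 0ℓ} {A B : Pred Vertex 0ℓ} {x xs ys} →
    A x → All (λ v → ¬ A v) xs → Linked E (x ∷ xs) → Unique (x ∷ xs) → AllButLast (λ v → ¬ B v) x xs →
    All (λ v → ¬ A v) ys → Linked E (last x xs ∷ ys) → Unique ys →
    AllButLast (λ v → ¬ B v) (last x xs) ys → B (last (last x xs) ys) →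
    (∀ {v} → v ∈ₗ x ∷ xs → v ∉ₗ ys) → IsLinkPath E A B x (xs ++ ys)
  ++-isLinkPath {B = B} {x} {xs} {ys} x∈A xs∉A linked₁ distinct₁ inner₁ ys∉A linked₂ distinct₂ inner₂ end∈B apart =
    record
      { first∈A = x∈A ; rest∉A = Allₚ.++⁺ xs∉A ys∉A ; linked = linked-++ linked₁ linked₂
      ; distinct = Uniqueₚ.++⁺ distinct₁ distinct₂ (λ (v∈₁ , v∈₂) → apart v∈₁ v∈₂)
      ; inner∉B = allButLast-++ inner₁ inner₂ ; last∈B = subst B (sym (last-++ x xs ys)) end∈B }

  relink : ∀ {E E′ k A B} (L : Linking E k A B) →
           (∀ i → Linked E′ (Linking.first L i ∷ Linking.rest L i)) → Linking E′ k A B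
  relink L linked′ = record
    { first = first ; rest = rest ; disjoint = disjoint
    ; isPath = λ i → let open IsLinkPath (isPath i) in record
        { first∈A = first∈A ; rest∉A = rest∉A ; linked = linked′ i
        ; distinct = distinct ; inner∉B = inner∉B ; last∈B = last∈B } }
    where open Linking L

  linking-mono : ∀ {E′ E : Rel Vertex 0ℓ} {k A B} → (∀ {u v} → E′ u v → E u v) →
                 Linking E′ k A B → Linking E k A B
  linking-mono E′⊆E L = relink L (λ i → Linked.map E′⊆E (IsLinkPath.linked (Linking.isPath L i)))

  EdgeBetween : Vertex → Vertex → Rel Vertex 0ℓ
  EdgeBetween x y u v = (u ≡ x × v ≡ y) ⊎ (u ≡ y × v ≡ x)

  edgeBetween-sym : ∀ {x y u v} → EdgeBetween x y u v → EdgeBetween y x u v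
  edgeBetween-sym = Sum.swap

  -- Apply the induction hypothesis between
  -- A and X = sep ∪ {x} and between Y = sep ∪ {y} and B: a small separator there also
  -- separates A from B in E, and otherwise the two linkages glue along sep and the edge xy.
  module CrossingEdge
    {E′ E : Rel Vertex 0ℓ} (E′⊆E : ∀ {u v} → E′ u v → E u v)
    {x y : Vertex} (E⊆E′+xy : ∀ {u v} → E u v → E′ u v ⊎ EdgeBetween x y u v) (xy∈E : E x y)
    {k : ℕ} (IH : ∀ {A B : Pred Vertex 0ℓ} → Decidable A → Decidable B → LinkingOrSeparation E′ k A B)
    {A B : Pred Vertex 0ℓ} (A? : Decidable A) (B? : Decidable B) (C : Separation E′ A B k)
    (x∈reach : Separation.reach C x) (y∉reach : ¬ Separation.reach C y)
    (x∉sep : x ∉ₗ Separation.sep C) (y∉sep : y ∉ₗ Separation.sep C) where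

    open Separation C

    X Y : Pred Vertex 0ℓ
    X v = v ∈ₗ x ∷ sep
    Y v = v ∈ₗ y ∷ sep

    x≢y : x ≢ y
    x≢y refl = y∉reach x∈reach

    X⊆reach∪sep : ∀ {v} → X v → reach v ⊎ v ∈ₗ sep
    X⊆reach∪sep (here refl) = inj₁ x∈reach
    X⊆reach∪sep (there v∈sep) = inj₂ v∈sep

    Y-unreached : ∀ {v} → Y v → ¬ reach v
    Y-unreached (here refl) = y∉reach
    Y-unreached (there v∈sep) v∈reach = reach∉sep v∈reach v∈sep

    -- A separation D of A from X along E′, intersected with C: its reach lies in reach C
    -- and avoids x ∈ X, so the new edge never leaves it.
    separation-A-X : Separation E′ A X k → Separation E A B k
    separation-A-X D = record
      { sep = D.sep ; sep-small = D.sep-small ; reach = λ v → reach v × D.reach v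
      ; reach? = λ v → reach? v ×-dec D.reach? v ; reach∉sep = λ (_ , v∈D) → D.reach∉sep v∈D
      ; A⊆reach∪sep = covered ; B-unreached = λ v∈B (v∈reach , _) → B-unreached v∈B v∈reach
      ; closed = closed-both }
      where
        module D = Separation D
        covered : ∀ {v} → A v → (reach v × D.reach v) ⊎ v ∈ₗ D.sep
        covered v∈A with D.A⊆reach∪sep v∈A | A⊆reach∪sep v∈A
        ... | inj₂ v∈Dsep | _ = inj₂ v∈Dsep
        ... | inj₁ v∈D | inj₁ v∈reach = inj₁ (v∈reach , v∈D)
        ... | inj₁ v∈D | inj₂ v∈sep = ⊥-elim (D.B-unreached (there v∈sep) v∈D)
        closed-both : ∀ {u v} → reach u × D.reach u → E u v → v ∉ₗ D.sep → reach v × D.reach v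
        closed-both {v = v} (u∈reach , u∈D) uv v∉Dsep with E⊆E′+xy uv
        ... | inj₁ uv′ = closed u∈reach uv′ (λ v∈sep → D.B-unreached (there v∈sep) v∈D) , v∈D
          where
            v∈D : D.reach v
            v∈D = D.closed u∈D uv′ v∉Dsep
        ... | inj₂ (inj₁ (refl , refl)) = ⊥-elim (D.B-unreached (here refl) u∈D)
        ... | inj₂ (inj₂ (refl , refl)) = ⊥-elim (y∉reach u∈reach)

    -- A separation D of Y from B along E′, united with the part of reach C outside D's
    -- separator: the new edge leads from x into y ∈ Y, or from y back into reach C.
    separation-Y-B : Separation E′ Y B k → Separation E A B k
    separation-Y-B D = record
      { sep = D.sep ; sep-small = D.sep-small ; reach = reach′
      ; reach? = λ v → (reach? v ×-dec ¬? (v ∈ₗ? D.sep)) ⊎-dec D.reach? v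
      ; reach∉sep = λ { (inj₁ (_ , v∉Dsep)) → v∉Dsep ; (inj₂ v∈D) → D.reach∉sep v∈D }
      ; A⊆reach∪sep = covered
      ; B-unreached = λ { v∈B (inj₁ (v∈reach , _)) → B-unreached v∈B v∈reach
                        ; v∈B (inj₂ v∈D) → D.B-unreached v∈B v∈D }
      ; closed = closed′ }
      where
        module D = Separation D
        reach′ : Pred Vertex 0ℓ
        reach′ v = (reach v × v ∉ₗ D.sep) ⊎ D.reach v
        Y⊆D : ∀ {v} → Y v → v ∉ₗ D.sep → D.reach v
        Y⊆D v∈Y v∉Dsep with D.A⊆reach∪sep v∈Y
        ... | inj₁ v∈D = v∈D
        ... | inj₂ v∈Dsep = ⊥-elim (v∉Dsep v∈Dsep)
        covered : ∀ {v} → A v → reach′ v ⊎ v ∈ₗ D.sep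
        covered {v} v∈A with v ∈ₗ? D.sep | A⊆reach∪sep v∈A
        ... | yes v∈Dsep | _ = inj₂ v∈Dsep
        ... | no v∉Dsep | inj₁ v∈reach = inj₁ (inj₁ (v∈reach , v∉Dsep))
        ... | no v∉Dsep | inj₂ v∈sep = inj₁ (inj₂ (Y⊆D (there v∈sep) v∉Dsep))
        closed′ : ∀ {u v} → reach′ u → E u v → v ∉ₗ D.sep → reach′ v
        closed′ {v = v} u∈ uv v∉Dsep with E⊆E′+xy uv | u∈
        ... | inj₂ (inj₁ (refl , refl)) | _ = inj₂ (Y⊆D (here refl) v∉Dsep)
        ... | inj₂ (inj₂ (refl , refl)) | inj₁ (u∈reach , _) = ⊥-elim (y∉reach u∈reach)
        ... | inj₂ (inj₂ (refl , refl)) | inj₂ _ = inj₁ (x∈reach , v∉Dsep)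
        ... | inj₁ uv′ | inj₂ u∈D = inj₂ (D.closed u∈D uv′ v∉Dsep)
        ... | inj₁ uv′ | inj₁ (u∈reach , _) with v ∈ₗ? sep
        ...   | yes v∈sep = inj₂ (Y⊆D (there v∈sep) v∉Dsep)
        ...   | no v∉sep = inj₁ (closed u∈reach uv′ v∉sep , v∉Dsep)

    -- k disjoint A–X paths Pᵢ and k disjoint Y–B paths Qⱼ along E′ combine into k disjoint
    -- A–B paths along E: each Pᵢ is continued by the Qⱼ starting where Pᵢ ends (or at y, if
    -- Pᵢ ends at x).  The Pᵢ run in reach C up to their ends, the Qⱼ outside it after their
    -- starts, so only the matched ends can meet.
    module Glue (LP : Linking E′ k A X) (LQ : Linking E′ k Y B) where
      module P = Linking LP
      module Q = Linking LQ
      open Counting (Finₚ._≟_ {n}) using (injection-onto)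

      end∈X : ∀ i → X (P.end i)
      end∈X i = IsLinkPath.last∈B (P.isPath i)

      start∈Y : ∀ j → Y (Q.first j)
      start∈Y j = IsLinkPath.first∈A (Q.isPath j)

      -- Pᵢ avoids X, hence sep, before its end; so it runs inside reach until its end.
      P-inner : ∀ i → AllButLast reach (P.first i) (P.rest i)
      P-inner i = inner-reached first∈A linked (allButLast-map (λ v∉X v∈sep → v∉X (there v∈sep)) inner∉B)
        where open IsLinkPath (P.isPath i)

      P-vertex : ∀ i {v} → v ∈ₗ P.vertices i → reach v ⊎ v ≡ P.end i
      P-vertex i = allButLast-∈ (P-inner i)

      -- After its start Qⱼ avoids Y, hence sep, and therefore also reach (it ends in B) and A.
      Q-rest∉sep : ∀ j → All (_∉ₗ sep) (Q.rest j)
      Q-rest∉sep j = All.map (λ v∉Y v∈sep → v∉Y (there v∈sep)) (IsLinkPath.rest∉A (Q.isPath j))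

      Q-rest∉reach : ∀ j → All (λ v → ¬ reach v) (Q.rest j)
      Q-rest∉reach j = unreached-after-start linked (Q-rest∉sep j) last∈B
        where open IsLinkPath (Q.isPath j)

      Q-rest∉A : ∀ j → All (λ v → ¬ A v) (Q.rest j)
      Q-rest∉A j = All.zipWith (λ (v∉reach , v∉sep) → outside⇒∉A v∉reach v∉sep) (Q-rest∉reach j , Q-rest∉sep j)

      Q-vertex : ∀ j {v} → v ∈ₗ Q.vertices j → v ≡ Q.first j ⊎ (¬ reach v × v ∉ₗ sep)
      Q-vertex j (here v≡start) = inj₁ v≡start
      Q-vertex j (there v∈) = inj₂ (All.lookup (Q-rest∉reach j) v∈ , All.lookup (Q-rest∉sep j) v∈)

      -- The Qⱼ start at k distinct vertices of Y, which has at most k vertices.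
      starting-at : ∀ {t} → Y t → ∃ λ j → Q.first j ≡ t
      starting-at = injection-onto Q.first Q.first-injective start∈Y sep-small

      Continues : Fin k → Fin k → Set
      Continues i j = (P.end i ≡ x × Q.first j ≡ y) ⊎ (P.end i ∈ₗ sep × Q.first j ≡ P.end i)

      successor : ∀ i → ∃ (Continues i)
      successor i with end∈X i
      ... | here end≡x = Product.map₂ (λ start≡y → inj₁ (end≡x , start≡y)) (starting-at (here refl))
      ... | there end∈sep = Product.map₂ (λ start≡end → inj₂ (end∈sep , start≡end)) (starting-at (there end∈sep))

      σ : Fin k → Fin k
      σ i = proj₁ (successor i)

      Extension : Fin k → Fin k → Set
      Extension i j = Σ (List Vertex) λ ws →
        IsLinkPath E A B (P.first i) (P.rest i ++ ws) × (∀ {v} → v ∈ₗ ws → v ∈ₗ Q.vertices j)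

      extend : ∀ i j → Continues i j → Extension i j
      extend i j (inj₁ (end≡x , start≡y)) = Q.vertices j , path , λ v∈ → v∈
        where
          module Pᵢ = IsLinkPath (P.isPath i)
          module Qⱼ = IsLinkPath (Q.isPath j)
          apart : ∀ {v} → v ∈ₗ P.vertices i → v ∉ₗ Q.vertices j
          apart v∈P v∈Q with P-vertex i v∈P | Q-vertex j v∈Q
          ... | inj₁ v∈reach | inj₁ v≡start = y∉reach (subst reach (trans v≡start start≡y) v∈reach)
          ... | inj₁ v∈reach | inj₂ (v∉reach , _) = v∉reach v∈reach
          ... | inj₂ v≡end | inj₁ v≡start = x≢y (trans (sym (trans v≡end end≡x)) (trans v≡start start≡y))
          ... | inj₂ v≡end | inj₂ (v∉reach , _) = v∉reach (subst reach (sym (trans v≡end end≡x)) x∈reach)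
          path : IsLinkPath E A B (P.first i) (P.rest i ++ Q.vertices j)
          path = ++-isLinkPath Pᵢ.first∈A Pᵢ.rest∉A (Linked.map E′⊆E Pᵢ.linked) Pᵢ.distinct
                   (allButLast-map (λ v∈reach v∈B → B-unreached v∈B v∈reach) (P-inner i))
                   (subst (λ v → ¬ A v) (sym start≡y) (outside⇒∉A y∉reach y∉sep) ∷ Q-rest∉A j)
                   (subst₂ E (sym end≡x) (sym start≡y) xy∈E ∷ Linked.map E′⊆E Qⱼ.linked) Qⱼ.distinct
                   ((λ end∈B → B-unreached end∈B (subst reach (sym end≡x) x∈reach)) , Qⱼ.inner∉B)
                   Qⱼ.last∈B apart
      extend i j (inj₂ (_ , start≡end)) = Q.rest j , path , there
        where
          module Pᵢ = IsLinkPath (P.isPath i)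
          module Qⱼ = IsLinkPath (Q.isPath j)
          apart : ∀ {v} → v ∈ₗ P.vertices i → v ∉ₗ Q.rest j
          apart v∈P v∈Q with P-vertex i v∈P
          ... | inj₁ v∈reach = All.lookup (Q-rest∉reach j) v∈Q v∈reach
          ... | inj₂ v≡end = All.lookup (AllPairs.head Qⱼ.distinct) v∈Q (trans start≡end (sym v≡end))
          path : IsLinkPath E A B (P.first i) (P.rest i ++ Q.rest j)
          path = ++-isLinkPath Pᵢ.first∈A Pᵢ.rest∉A (Linked.map E′⊆E Pᵢ.linked) Pᵢ.distinct
                   (allButLast-map (λ v∈reach v∈B → B-unreached v∈B v∈reach) (P-inner i))
                   (Q-rest∉A j)
                   (subst (λ z → Linked E (z ∷ Q.rest j)) start≡end (Linked.map E′⊆E Qⱼ.linked))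
                   (AllPairs.tail Qⱼ.distinct)
                   (subst (λ z → AllButLast (λ v → ¬ B v) z (Q.rest j)) start≡end Qⱼ.inner∉B)
                   (subst (λ z → B (last z (Q.rest j))) start≡end Qⱼ.last∈B) apart

      junction : ∀ {i i′ j} → Continues i′ j → P.end i ≡ Q.first j → i ≡ i′
      junction {i} (inj₁ (_ , start≡y)) end≡start with end∈X i
      ... | here end≡x = ⊥-elim (x≢y (trans (sym end≡x) (trans end≡start start≡y)))
      ... | there end∈sep = ⊥-elim (y∉sep (subst (_∈ₗ sep) (trans end≡start start≡y) end∈sep))
      junction (inj₂ (_ , start≡end′)) end≡start = P.end-injective (trans end≡start start≡end′)

      P∩Q⇒≡ : ∀ i {i′ j v} → Continues i′ j →
              v ∈ₗ P.vertices i → v ∈ₗ Q.vertices j → i ≡ i′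
      P∩Q⇒≡ i continues v∈P v∈Q with P-vertex i v∈P | Q-vertex _ v∈Q
      ... | inj₁ v∈reach | inj₁ v≡start = ⊥-elim (Y-unreached (start∈Y _) (subst reach v≡start v∈reach))
      ... | inj₁ v∈reach | inj₂ (v∉reach , _) = ⊥-elim (v∉reach v∈reach)
      ... | inj₂ v≡end | inj₁ v≡start = junction continues (trans (sym v≡end) v≡start)
      ... | inj₂ v≡end | inj₂ (v∉reach , v∉sep) with X⊆reach∪sep (end∈X i)
      ...   | inj₁ end∈reach = ⊥-elim (v∉reach (subst reach (sym v≡end) end∈reach))
      ...   | inj₂ end∈sep = ⊥-elim (v∉sep (subst (_∈ₗ sep) (sym v≡end) end∈sep))

      continuation-injective : ∀ {i i′ j j′} → Continues i j → Continues i′ j′ → j ≡ j′ → i ≡ i′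
      continuation-injective (inj₁ (end≡x , _)) (inj₁ (end′≡x , _)) refl = P.end-injective (trans end≡x (sym end′≡x))
      continuation-injective continues (inj₂ (_ , start≡end′)) refl = sym (junction continues (sym start≡end′))
      continuation-injective (inj₂ (_ , start≡end)) continues′ refl = junction continues′ (sym start≡end)

      linking : Linking E k A B
      linking = record
        { first = P.first ; rest = λ i → P.rest i ++ proj₁ (extension i)
        ; isPath = λ i → proj₁ (proj₂ (extension i)) ; disjoint = disjoint }
        where
          extension : ∀ i → Extension i (σ i)
          extension i = extend i (σ i) (proj₂ (successor i))
          part : ∀ i {v} → v ∈ₗ P.vertices i ++ proj₁ (extension i) →
                 v ∈ₗ P.vertices i ⊎ v ∈ₗ Q.vertices (σ i)
          part i v∈ = Sum.map₂ (proj₂ (proj₂ (extension i))) (∈-++⁻ (P.vertices i) v∈)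
          disjoint : ∀ i i′ {v} → v ∈ₗ P.vertices i ++ proj₁ (extension i) →
                     v ∈ₗ P.vertices i′ ++ proj₁ (extension i′) → i ≡ i′
          disjoint i i′ v∈ v∈′ with part i v∈ | part i′ v∈′
          ... | inj₁ v∈P | inj₁ v∈P′ = P.disjoint i i′ v∈P v∈P′
          ... | inj₁ v∈P | inj₂ v∈Q′ = P∩Q⇒≡ i (proj₂ (successor i′)) v∈P v∈Q′
          ... | inj₂ v∈Q | inj₁ v∈P′ = sym (P∩Q⇒≡ i′ (proj₂ (successor i)) v∈P′ v∈Q)
          ... | inj₂ v∈Q | inj₂ v∈Q′ =
            continuation-injective (proj₂ (successor i)) (proj₂ (successor i′)) (Q.disjoint _ _ v∈Q v∈Q′)

    linkingOrSeparation : LinkingOrSeparation E k A B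
    linkingOrSeparation with IH A? (λ v → v ∈ₗ? x ∷ sep)
    ... | inj₂ D = inj₂ (separation-A-X D)
    ... | inj₁ LP with IH (λ v → v ∈ₗ? y ∷ sep) B?
    ...   | inj₂ D = inj₂ (separation-Y-B D)
    ...   | inj₁ LQ = inj₁ (Glue.linking LP LQ)

  Edges : Set
  Edges = List (Vertex × Vertex)

  Adj : Edges → Rel Vertex 0ℓ
  Adj es u v = (u , v) ∈ₗ es ⊎ (v , u) ∈ₗ es

  Adj-∷⁺ : ∀ {e es u v} → Adj es u v → Adj (e ∷ es) u v
  Adj-∷⁺ = Sum.map there there

  Adj-∷⁻ : ∀ {x y es u v} → Adj ((x , y) ∷ es) u v → Adj es u v ⊎ EdgeBetween x y u v
  Adj-∷⁻ (inj₁ (here refl)) = inj₂ (inj₁ (refl , refl))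
  Adj-∷⁻ (inj₁ (there uv∈)) = inj₁ (inj₁ uv∈)
  Adj-∷⁻ (inj₂ (here refl)) = inj₂ (inj₂ (refl , refl))
  Adj-∷⁻ (inj₂ (there vu∈)) = inj₁ (inj₂ vu∈)

  module _ {E : Rel Vertex 0ℓ} {A B : Pred Vertex 0ℓ} {k : ℕ} (C : Separation E A B k) where
    open Separation C

    Respects : Vertex → Vertex → Set
    Respects x y = ∀ {u v} → reach u → EdgeBetween x y u v → v ∉ₗ sep → reach v

    Crosses : Vertex → Vertex → Set
    Crosses x y = reach x × ¬ reach y × x ∉ₗ sep × y ∉ₗ sep

    respects-or-crosses : ∀ x y → Respects x y ⊎ (Crosses x y ⊎ Crosses y x)
    respects-or-crosses x y with x ∈ₗ? sep | y ∈ₗ? sep | reach? x | reach? y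
    ... | yes x∈sep | _ | _ | _ = inj₁ λ
      { u∈reach (inj₁ (refl , refl)) _ → ⊥-elim (reach∉sep u∈reach x∈sep)
      ; _ (inj₂ (refl , refl)) v∉sep → ⊥-elim (v∉sep x∈sep) }
    ... | no _ | yes y∈sep | _ | _ = inj₁ λ
      { _ (inj₁ (refl , refl)) v∉sep → ⊥-elim (v∉sep y∈sep)
      ; u∈reach (inj₂ (refl , refl)) _ → ⊥-elim (reach∉sep u∈reach y∈sep) }
    ... | no _ | no _ | yes x∈reach | yes y∈reach = inj₁ λ
      { _ (inj₁ (refl , refl)) _ → y∈reach ; _ (inj₂ (refl , refl)) _ → x∈reach }
    ... | no _ | no _ | no x∉reach | no y∉reach = inj₁ λ
      { u∈reach (inj₁ (refl , refl)) _ → ⊥-elim (x∉reach u∈reach)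
      ; u∈reach (inj₂ (refl , refl)) _ → ⊥-elim (y∉reach u∈reach) }
    ... | no x∉sep | no y∉sep | yes x∈reach | no y∉reach = inj₂ (inj₁ (x∈reach , y∉reach , x∉sep , y∉sep))
    ... | no x∉sep | no y∉sep | no x∉reach | yes y∈reach = inj₂ (inj₂ (y∈reach , x∉reach , y∉sep , x∉sep))

  separation-extend : ∀ {E′ E : Rel Vertex 0ℓ} {A B k x y} →
    (∀ {u v} → E u v → E′ u v ⊎ EdgeBetween x y u v) →
    (C : Separation E′ A B k) → Respects C x y → Separation E A B k
  separation-extend {E = E} E⊆E′+xy C respects = record
    { sep = sep ; sep-small = sep-small ; reach = reach ; reach? = reach? ; reach∉sep = reach∉sep
    ; A⊆reach∪sep = A⊆reach∪sep ; B-unreached = B-unreached ; closed = closed′ }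
    where
      open Separation C
      closed′ : ∀ {u v} → reach u → E u v → v ∉ₗ sep → reach v
      closed′ u∈reach uv v∉sep with E⊆E′+xy uv
      ... | inj₁ uv′ = closed u∈reach uv′ v∉sep
      ... | inj₂ new = respects u∈reach new v∉sep

  menger : ∀ (es : Edges) k {A B : Pred Vertex 0ℓ} → Decidable A → Decidable B →
           LinkingOrSeparation (Adj es) k A B
  menger [] k A? B? = Edgeless.linkingOrSeparation (λ { (inj₁ ()) ; (inj₂ ()) }) A? B? k
  menger ((x , y) ∷ es) k A? B? with menger es k A? B?
  ... | inj₁ L = inj₁ (linking-mono Adj-∷⁺ L)
  ... | inj₂ C with respects-or-crosses C x y
  ...   | inj₁ respects = inj₂ (separation-extend Adj-∷⁻ C respects)
  ...   | inj₂ (inj₁ (x∈reach , y∉reach , x∉sep , y∉sep)) =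
    CrossingEdge.linkingOrSeparation Adj-∷⁺ Adj-∷⁻ (inj₁ (here refl)) (menger es k) A? B? C
      x∈reach y∉reach x∉sep y∉sep
  ...   | inj₂ (inj₂ (y∈reach , x∉reach , y∉sep , x∉sep)) =
    CrossingEdge.linkingOrSeparation Adj-∷⁺ (Sum.map₂ edgeBetween-sym ∘ Adj-∷⁻) (inj₂ (here refl)) (menger es k) A? B? C
      y∈reach x∉reach y∉sep x∉sep

  edgesOf : List Vertex → Edges
  edgesOf [] = []
  edgesOf (u ∷ []) = []
  edgesOf (u ∷ v ∷ ws) = (u , v) ∷ edgesOf (v ∷ ws)

  edgesOf-sound : ∀ {E : Rel Vertex 0ℓ} {vs u v} → Linked E vs → (u , v) ∈ₗ edgesOf vs → E u v
  edgesOf-sound {vs = _ ∷ _ ∷ _} (uv ∷ _) (here refl) = uv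
  edgesOf-sound {vs = _ ∷ _ ∷ _} (_ ∷ linked) (there e∈) = edgesOf-sound linked e∈

  linked-Adj : ∀ {es} vs → (∀ {e} → e ∈ₗ edgesOf vs → e ∈ₗ es) → Linked (Adj es) vs
  linked-Adj [] _ = []
  linked-Adj (u ∷ []) _ = [-]
  linked-Adj (u ∷ v ∷ ws) ⊆es = inj₁ (⊆es (here refl)) ∷ linked-Adj (v ∷ ws) (⊆es ∘ there)

  linkingEdges : ∀ {E k A B} → Linking E k A B → Edges
  linkingEdges {k = k} L = List.concatMap (edgesOf ∘ Linking.vertices L) (allFin k)

  linkingEdges-sound : ∀ {E k A B} (L : Linking E k A B) {u v} → (u , v) ∈ₗ linkingEdges L → E u v
  linkingEdges-sound {k = k} L e∈ =
    let i , e∈i = Any.satisfied (∈-concatMap⁻ (edgesOf ∘ Linking.vertices L) {xs = allFin k} e∈)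
    in edgesOf-sound (IsLinkPath.linked (Linking.isPath L i)) e∈i

  restrict : ∀ {E k A B es} (L : Linking E k A B) → (∀ {e} → e ∈ₗ linkingEdges L → e ∈ₗ es) →
             Linking (Adj es) k A B
  restrict L ⊆es = relink L (λ i → linked-Adj (vertices i) (⊆es ∘ used i))
    where
      open Linking L
      used : ∀ i {e} → e ∈ₗ edgesOf (vertices i) → e ∈ₗ linkingEdges L
      used i e∈ = ∈-concatMap⁺ (edgesOf ∘ vertices) (Any.map (λ { refl → e∈ }) (∈-allFin i))

members : ∀ {n} → Subset n → List (Fin n)
members {n} p = filter (_∈? p) (allFin n)

length-filter-suc : ∀ {n m} s (p : Subset n) (f : Fin m → Fin n) →
  length (filter (_∈? (s ∷ p)) (List.tabulate (λ i → suc (f i)))) ≡ length (filter (_∈? p) (List.tabulate f))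
length-filter-suc {m = zero} s p f = refl
length-filter-suc {m = suc m} s p f with f zero ∈? p
... | yes _ = cong suc (length-filter-suc s p (λ i → f (suc i)))
... | no _ = length-filter-suc s p (λ i → f (suc i))

length-members : ∀ {n} (p : Subset n) → length (members p) ≡ ∣ p ∣
length-members {zero} [] = refl
length-members {suc n} (inside ∷ p) = cong suc (trans (length-filter-suc inside p (λ i → i)) (length-members p))
length-members {suc n} (outside ∷ p) = trans (length-filter-suc outside p (λ i → i)) (length-members p)

2k∸1≰s+s : ∀ {k s} → 1 ≤ k → s < k → ¬ (2 * k ∸ 1 ≤ s + s)
2k∸1≰s+s {suc k} _ (s≤s s≤k) 2k∸1≤s+s =
  ℕₚ.<-irrefl refl (subst (_≤ k) (cong suc (ℕₚ.+-identityʳ k))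
    (ℕₚ.+-cancelˡ-≤ k _ _ (ℕₚ.≤-trans 2k∸1≤s+s (ℕₚ.+-mono-≤ s≤k s≤k))))

module _ (G : Graph) where
  open Graph G
  open Menger n
  open import Data.List.Membership.DecPropositional (Finₚ._≟_ {n}) using () renaming (_∈?_ to _∈ₗ?_)

  fromABPath : ∀ {A B : Subset n} {vs} → IsABPath G A B vs →
               ∃ λ x → ∃ λ xs → vs ≡ x ∷ xs × IsLinkPath _~_ (_∈ A) (_∈ B) x xs
  fromABPath {B = B} ((_ , linked , distinct) , (x , xs , vs≡x∷xs , x∈A , xs∉A) , (ini , b , vs≡ini∷ʳb , b∈B , ini∉B)) =
    x , xs , vs≡x∷xs , record
      { first∈A = x∈A ; rest∉A = xs∉A
      ; linked = subst (Linked _~_) vs≡x∷xs linked ; distinct = subst Unique vs≡x∷xs distinct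
      ; inner∉B = All-init⇒allButLast x xs (subst (All (_∉ B)) (proj₁ ends) ini∉B)
      ; last∈B = subst (_∈ B) (proj₂ ends) b∈B }
    where
      ends : ini ≡ init x xs × b ≡ last x xs
      ends = Listₚ.∷ʳ-injective ini (init x xs) (trans (sym vs≡ini∷ʳb) (trans vs≡x∷xs (init-∷ʳ-last x xs)))

  fromLinkage : ∀ {m} {A B : Subset n} → Linkage G m A B → Linking _~_ m (_∈ A) (_∈ B)
  fromLinkage {A = A} {B} (P , isABPath , disjoint) = record
    { first = λ i → proj₁ (split i) ; rest = λ i → proj₁ (proj₂ (split i))
    ; isPath = λ i → proj₂ (proj₂ (proj₂ (split i)))
    ; disjoint = λ i j {v} v∈i v∈j → disjoint i j v (subst (v ∈ₗ_) (sym (P≡ i)) v∈i) (subst (v ∈ₗ_) (sym (P≡ j)) v∈j) }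
    where
      split : ∀ i → ∃ λ x → ∃ λ xs → P i ≡ x ∷ xs × IsLinkPath _~_ (_∈ A) (_∈ B) x xs
      split i = fromABPath (isABPath i)
      P≡ : ∀ i → P i ≡ proj₁ (split i) ∷ proj₁ (proj₂ (split i))
      P≡ i = proj₁ (proj₂ (proj₂ (split i)))

  toABPath : ∀ {E : Rel (Fin n) 0ℓ} {A B : Subset n} {x xs} → (∀ {u v} → E u v → u ~ v) →
             IsLinkPath E (_∈ A) (_∈ B) x xs → IsABPath G A B (x ∷ xs)
  toABPath {x = x} {xs} E⊆~ p =
    ((x , xs , refl) , Linked.map E⊆~ linked , distinct)
    , (x , xs , refl , first∈A , rest∉A)
    , (init x xs , last x xs , init-∷ʳ-last x xs , last∈B , allButLast⇒All-init x xs inner∉B)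
    where open IsLinkPath p

  toLinkage : ∀ {E : Rel (Fin n) 0ℓ} {k} {A B : Subset n} → (∀ {u v} → E u v → u ~ v) →
              Linking E k (_∈ A) (_∈ B) → Linkage G k A B
  toLinkage E⊆~ L = vertices , (λ i → toABPath E⊆~ (isPath i)) , (λ i j _ → disjoint i j)
    where open Linking L

  module Sandwich {k : ℕ} {A B C : Subset n} (k≥1 : 1 ≤ k) (|B|≡2k∸1 : ∣ B ∣ ≡ 2 * k ∸ 1)
    (LP : Linking _~_ (2 * k ∸ 1) (_∈ A) (_∈ B)) (LQ : Linking _~_ (2 * k ∸ 1) (_∈ B) (_∈ C)) where

    H : Edges
    H = linkingEdges LP ++ linkingEdges LQ

    H-edge : ∀ {u v} → (u , v) ∈ₗ H → u ~ v
    H-edge uv∈H = Sum.[ linkingEdges-sound LP , linkingEdges-sound LQ ] (∈-++⁻ (linkingEdges LP) uv∈H)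

    H⊆G : ∀ {u v} → Adj H u v → u ~ v
    H⊆G (inj₁ uv∈H) = H-edge uv∈H
    H⊆G (inj₂ vu∈H) = ~-sym (H-edge vu∈H)

    module P = Linking (restrict {es = H} LP ∈-++⁺ˡ)
    module Q = Linking (restrict {es = H} LQ (∈-++⁺ʳ (linkingEdges LP)))

    -- The Qⱼ start at 2k-1 distinct vertices of B, hence at all of them: every Pᵢ
    -- ends where some Qⱼ starts.
    successor : ∀ i → ∃ λ j → Q.first j ≡ P.end i
    successor i = injection-onto Q.first Q.first-injective (λ j → member (IsLinkPath.first∈A (Q.isPath j)))
                    (ℕₚ.≤-reflexive (trans (length-members B) |B|≡2k∸1)) (member (IsLinkPath.last∈B (P.isPath i)))
      where
        open Counting (Finₚ._≟_ {n}) using (injection-onto)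
        member : ∀ {v} → v ∈ B → v ∈ₗ members B
        member {v} v∈B = ∈-filter⁺ (_∈? B) (∈-allFin v) v∈B

    -- No set of fewer than k vertices separates A from C in H: it would have to meet
    -- each walk Pᵢ Qⱼ, so the 2k-1 disjoint Pᵢ and the 2k-1 disjoint Qⱼ would need
    -- 2k-1 distinct (vertex, side) pairs from the separator.
    module _ (S : Separation (Adj H) (_∈ A) (_∈ C) k) where
      open Separation S

      Blocked : Fin (2 * k ∸ 1) → Set
      Blocked i = (∃ λ v → v ∈ₗ sep × v ∈ₗ P.vertices i)
                ⊎ (∃ λ v → v ∈ₗ sep × ∃ λ j → v ∈ₗ Q.vertices j × Q.first j ≡ P.end i)

      -- If sep misses Pᵢ, then Pᵢ ends in reach, and the Qⱼ starting there must meet sep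
      -- before reaching C.
      blocked : ∀ i → Blocked i
      blocked i with Any.any? (_∈ₗ? sep) (P.vertices i)
      ... | yes hit = let v , v∈P , v∈sep = find hit in inj₁ (v , v∈sep , v∈P)
      ... | no miss = blocked-on-Q (proj₁ (successor i)) (proj₂ (successor i))
        where
          P∉sep : All (_∉ₗ sep) (P.vertices i)
          P∉sep = ¬Any⇒All¬ _ miss
          end∈reach : reach (P.end i)
          end∈reach with A⊆reach∪sep (IsLinkPath.first∈A (P.isPath i))
          ... | inj₁ first∈reach = reach-along first∈reach (IsLinkPath.linked (P.isPath i)) (All.tail P∉sep)
          ... | inj₂ first∈sep = ⊥-elim (All.head P∉sep first∈sep)
          blocked-on-Q : ∀ j → Q.first j ≡ P.end i → Blocked i
          blocked-on-Q j start≡end with Any.any? (_∈ₗ? sep) (Q.vertices j)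
          ... | yes hit = let v , v∈Q , v∈sep = find hit in inj₂ (v , v∈sep , j , v∈Q , start≡end)
          ... | no miss′ = ⊥-elim (B-unreached last∈B
                  (reach-along (subst reach (sym start≡end) end∈reach) linked (All.tail (¬Any⇒All¬ _ miss′))))
            where open IsLinkPath (Q.isPath j)

      tag : ∀ {i} → Blocked i → Vertex ⊎ Vertex
      tag (inj₁ (v , _)) = inj₁ v
      tag (inj₂ (v , _)) = inj₂ v

      tag∈ : ∀ {i} (b : Blocked i) → tag b ∈ₗ map inj₁ sep ++ map inj₂ sep
      tag∈ (inj₁ (_ , v∈sep , _)) = ∈-++⁺ˡ (∈-map⁺ inj₁ v∈sep)
      tag∈ (inj₂ (_ , v∈sep , _)) = ∈-++⁺ʳ (map inj₁ sep) (∈-map⁺ inj₂ v∈sep)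

      -- Disjointness of the Pᵢ, of the Qⱼ and of the ends of the Pᵢ make the tags distinct.
      tag-injective : ∀ {i i′} (b : Blocked i) (b′ : Blocked i′) → tag b ≡ tag b′ → i ≡ i′
      tag-injective {i} {i′} (inj₁ (_ , _ , v∈P)) (inj₁ (_ , _ , v∈P′)) refl = P.disjoint i i′ v∈P v∈P′
      tag-injective (inj₁ _) (inj₂ _) ()
      tag-injective (inj₂ _) (inj₁ _) ()
      tag-injective (inj₂ (_ , _ , j , v∈Q , start≡end)) (inj₂ (_ , _ , j′ , v∈Q′ , start≡end′)) refl =
        P.end-injective (trans (sym start≡end) (trans (cong Q.first (Q.disjoint j j′ v∈Q v∈Q′)) start≡end′))

      no-small-separator : ⊥
      no-small-separator = 2k∸1≰s+s k≥1 sep-small (subst (2 * k ∸ 1 ≤_) length-tags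
        (injection⇒≤ (tag ∘ blocked) (λ {i} {i′} → tag-injective (blocked i) (blocked i′)) (λ i → tag∈ (blocked i))))
        where
          open Counting (≡-dec (Finₚ._≟_ {n}) (Finₚ._≟_ {n})) using (injection⇒≤)
          length-tags : length (map inj₁ sep ++ map (inj₂ {A = Vertex}) sep) ≡ length sep + length sep
          length-tags = trans (Listₚ.length-++ (map inj₁ sep))
                              (cong₂ _+_ (Listₚ.length-map inj₁ sep) (Listₚ.length-map inj₂ sep))

    linkage : Linkage G k A C
    linkage with menger H k (_∈? A) (_∈? C)
    ... | inj₁ L = toLinkage H⊆G L
    ... | inj₂ S = ⊥-elim (no-small-separator S)

lemma16 : (G : Graph) (k : ℕ) → 1 ≤ k → (A B C : Subset (Graph.n G))
          → ∣ B ∣ ≡ 2 * k ∸ 1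
          → Linkage G (2 * k ∸ 1) A B → Linkage G (2 * k ∸ 1) B C
          → Linkage G k A C
lemma16 G k k≥1 A B C |B|≡2k∸1 LAB LBC =
  Sandwich.linkage G k≥1 |B|≡2k∸1 (fromLinkage G LAB) (fromLinkage G LBC)
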